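{- Let $T$ be a tree with maximal degree $\Delta>2$ and let $n'$ be the number of nodes of $T^2$. Let $\delta_T=\min\{deg(v): v \text{ a node of } T \text{ with } deg(v)>2\}$. Then $|E_{pure}(T)|\le 2^{(n'-2)/(\delta_T-1)-1}$.
   Context: For a tree $T=(V,E)$, $E_{pure}(T)$ is the set of all $F\subseteq E$ with $2deg_F(u)<deg(u)$ for every $u\in V$, where $deg_F(u)$ is the number of edges of $F$ incident to $u$ and $deg(u)$ is the degree of $u$ in $T$. $T^2$ is the tree obtained from $T$ by repeatedly removing a node $w$ of degree $2$ and joining its two neighbors by a new edge, until no node of degree $2$ remains; it is uniquely defined. -}

module Defs where

open import Data.Nat using (ℕ; zero; suc; _+_; _*_; _≤_; _<_; _<?_)
open import Data.Fin using (Fin; punchIn)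
open import Data.Fin.Properties using (all?) renaming (_≟_ to _≟ᶠ_)
open import Data.Product using (Σ; ∃; ∃-syntax; _×_; _,_)
open import Data.Sum using (_⊎_)
open import Data.List using (List; []; _∷_; length; filter; map; _++_; [_])
open import Data.List.Membership.Propositional using (_∈_)
open import Data.List.Relation.Unary.All using (All)
open import Data.List.Relation.Unary.AllPairs using (AllPairs)
open import Data.List.Relation.Unary.Linked using (Linked)
open import Data.List.Relation.Unary.Unique.Propositional using (Unique)
open import Relation.Binary.PropositionalEquality using (_≡_; _≢_; refl)
open import Relation.Binary.Construct.Closure.ReflexiveTransitive using (Star)
open import Relation.Nullary using (¬_; Dec)
open import Data.Empty using (⊥)
open import Relation.Nullary.Decidable using (_⊎-dec_)
open import Function.Bundles using (_⇔_)

-- A (simple, undirected) graph on the vertex set Fin n is given by a list of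
-- edges; the edge (u , v) is the unordered pair {u , v}.
Edge : ℕ → Set
Edge n = Fin n × Fin n

SameEdge : ∀ {n} → Edge n → Edge n → Set
SameEdge (a , b) (c , d) = (a ≡ c × b ≡ d) ⊎ (a ≡ d × b ≡ c)

Simple : ∀ {n} → List (Edge n) → Set
Simple E = All (λ { (a , b) → a ≢ b }) E × AllPairs (λ e e′ → ¬ SameEdge e e′) E

Adj : ∀ {n} → List (Edge n) → Fin n → Fin n → Set
Adj E x y = ((x , y) ∈ E) ⊎ ((y , x) ∈ E)

Connected : ∀ {n} → List (Edge n) → Set
Connected {n} E = (u v : Fin n) → Star (Adj E) u v

IsCycle : ∀ {n} → List (Edge n) → List (Fin n) → Set
IsCycle E []       = ⊥
IsCycle E (x ∷ xs) = 3 ≤ length (x ∷ xs) × Unique (x ∷ xs) × Linked (Adj E) ((x ∷ xs) ++ [ x ])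

Acyclic : ∀ {n} → List (Edge n) → Set
Acyclic {n} E = (c : List (Fin n)) → ¬ IsCycle E c

IsTree : (n : ℕ) → List (Edge n) → Set
IsTree n E = 1 ≤ n × Simple E × Connected E × Acyclic E

Incident : ∀ {n} → Fin n → Edge n → Set
Incident u (a , b) = (u ≡ a) ⊎ (u ≡ b)

incident? : ∀ {n} (u : Fin n) (e : Edge n) → Dec (Incident u e)
incident? u (a , b) = (u ≟ᶠ a) ⊎-dec (u ≟ᶠ b)

deg : ∀ {n} → List (Edge n) → Fin n → ℕ
deg E u = length (filter (incident? u) E)

-- all sub(multi)sets of a list, i.e. all subsets of E when E has no repeats
sublists : ∀ {a} {A : Set a} → List A → List (List A)
sublists []       = [] ∷ []
sublists (x ∷ xs) = sublists xs ++ map (x ∷_) (sublists xs)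

Pure : ∀ {n} → List (Edge n) → List (Edge n) → Set
Pure {n} E F = (u : Fin n) → 2 * deg F u < deg E u

pure? : ∀ {n} (E F : List (Edge n)) → Dec (Pure E F)
pure? E F = all? (λ u → 2 * deg F u <? deg E u)

numPure : ∀ {n} → List (Edge n) → ℕ
numPure E = length (filter (pure? E) (sublists E))

-- One smoothing step: remove the degree-2 vertex w of the graph (suc n , E)
-- (whose two neighbours are a ≠ b) and join a and b by a new edge; the
-- remaining vertices are renumbered by punchIn w : Fin n → Fin (suc n).
Smooth : (Σ ℕ λ n → List (Edge n)) → (Σ ℕ λ n → List (Edge n)) → Set
Smooth (zero , E) _ = ⊥
Smooth (suc n , E) (m , E′) =
  Σ (m ≡ n) λ { refl →
    ∃[ w ] ∃[ a ] ∃[ b ]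
      deg E w ≡ 2 × Adj E w a × Adj E w b × a ≢ b × Simple E′ ×
      ((x y : Fin n) →
        Adj E′ x y ⇔ (Adj E (punchIn w x) (punchIn w y)
                      ⊎ SameEdge (punchIn w x , punchIn w y) (a , b))) }

NoDeg2 : (Σ ℕ λ n → List (Edge n)) → Set
NoDeg2 (n , E) = (v : Fin n) → deg E v ≢ 2

-- T2 is the (unique) result T^2 of smoothing T until no degree-2 node remains
IsSmoothing : (T T2 : Σ ℕ λ n → List (Edge n)) → Set
IsSmoothing T T2 = Star Smooth T T2 × NoDeg2 T2

{-# OPTIONS --safe #-}
module Submission where

-- Both endpoints of an edge of a pure set have degree ≥ 3, so |E_pure(T)| ≤ 2^m where m is the number of
-- such "good" edges. They form a forest on the k vertices of degree ≥ 3, hence m + 1 ≤ k. Since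
-- Σ_v (deg v − 2) = −2 and every vertex of degree ≥ 3 contributes at least δ − 2, also k (δ − 1) + 2 ≤ #{v : deg v ≠ 2}.
-- Smoothing a degree-2 vertex keeps the graph a tree and leaves all other degrees unchanged, so this number is the
-- number n' of nodes of T². Hence |E_pure|^(δ−1) · 2^(δ−1) ≤ 2^((m+1)(δ−1)) ≤ 2^(k(δ−1)) ≤ 2^(n'−2).

open import Defs
open import Level using (Level)
open import Data.Nat using (ℕ; zero; suc; _+_; _*_; _≤_; _<_; _^_; _∸_; z≤n; s≤s; z<s; _≤?_; _≟_)
open import Data.Nat.Properties
open import Data.Nat.Induction using (<-wellFounded)
open import Data.Fin using (Fin; zero; suc; punchIn)
open import Data.Fin.Properties using (punchIn-injective; punchInᵢ≢i; any?) renaming (_≟_ to _≟ᶠ_)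
open import Data.Product using (∃; ∃-syntax; _×_; _,_; proj₁; proj₂)
open import Data.Product.Properties using (≡-dec)
open import Data.Sum using (_⊎_; inj₁; inj₂)
import Data.Sum
open import Data.Empty using (⊥-elim)
open import Data.List using (List; []; _∷_; length; filter; map; _++_; [_])
open import Data.List.Properties
  using (length-++; ++-assoc; map-++; length-map; ∷-injectiveʳ; filter-++; filter-some; filter-accept; filter-reject; filter-none)
open import Data.List.Membership.Propositional using (_∈_; lose)
open import Data.List.Membership.Propositional.Properties using (∈-∃++; ∈-filter⁻)
open import Data.List.Relation.Unary.Any using (here; there)
open import Data.List.Relation.Unary.All using (All; []; _∷_; all?; universal; tabulate; zip; tail) renaming (lookup to All-lookup)
import Data.List.Relation.Unary.All.Properties as All
open import Data.List.Relation.Unary.AllPairs using (AllPairs; []; _∷_)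
import Data.List.Relation.Unary.AllPairs.Properties as AllPairs
open import Data.List.Relation.Unary.Linked using (Linked; []; [-]; _∷_)
import Data.List.Relation.Unary.Linked as Linked
import Data.List.Relation.Unary.Linked.Properties as Linked
open import Data.List.Relation.Unary.Unique.Propositional using (Unique)
import Data.List.Relation.Unary.Unique.Propositional.Properties as Unique
open import Data.List.Relation.Binary.Sublist.Propositional using (_⊆_; ⊆-refl)
open import Data.List.Relation.Binary.Sublist.Propositional.Properties using (filter⁺; filter-⊆; length-mono-≤)
open import Function using (_∘_; id)
open import Function.Bundles using (_⇔_; Equivalence)
open import Induction.WellFounded using (Acc; acc)
open import Relation.Nullary using (¬_; Dec; yes; no; contradiction)
open import Relation.Nullary.Decidable using (_⊎-dec_; _×-dec_; ¬?; decidable-stable)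
open import Relation.Unary using (Pred; Decidable)
open import Relation.Unary.Properties using (∁?)
open import Relation.Binary using (DecidableEquality) renaming (Decidable to Decidable₂)
open import Relation.Binary.Construct.Closure.ReflexiveTransitive using (Star; ε; _◅_)
open import Relation.Binary.PropositionalEquality using (_≡_; _≢_; refl; sym; trans; cong; cong₂; subst; subst₂; module ≡-Reasoning)
open import Algebra.Properties.Semiring.Sum +-*-semiring
  using (sum; sum-cong-≗; ∑-distrib-+; sum-remove; sum-replicate-zero; *-distribʳ-sum)

private
  variable
    p q r : Level
    P Q R : Set p

𝟙 : Dec P → ℕ
𝟙 (yes _) = 1
𝟙 (no _)  = 0

𝟙-mono : (P → Q) → (P? : Dec P) (Q? : Dec Q) → 𝟙 P? ≤ 𝟙 Q?
𝟙-mono f (yes p) (yes _) = ≤-refl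
𝟙-mono f (yes p) (no ¬q) = contradiction (f p) ¬q
𝟙-mono f (no _)  _       = z≤n

𝟙-cong : (P → Q) → (Q → P) → (P? : Dec P) (Q? : Dec Q) → 𝟙 P? ≡ 𝟙 Q?
𝟙-cong f g P? Q? = ≤-antisym (𝟙-mono f P? Q?) (𝟙-mono g Q? P?)

𝟙-yes : (P? : Dec P) → P → 𝟙 P? ≡ 1
𝟙-yes (yes _) _ = refl
𝟙-yes (no ¬p) p = contradiction p ¬p

𝟙-no : (P? : Dec P) → ¬ P → 𝟙 P? ≡ 0
𝟙-no (yes p) ¬p = contradiction p ¬p
𝟙-no (no _)  _  = refl

𝟙≤1 : (P? : Dec P) → 𝟙 P? ≤ 1
𝟙≤1 (yes _) = ≤-refl
𝟙≤1 (no _)  = z≤n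

𝟙-⊎ : (P → Q ⊎ R) → (Q → P) → (R → P) → (Q → ¬ R) →
      (P? : Dec P) (Q? : Dec Q) (R? : Dec R) → 𝟙 P? ≡ 𝟙 Q? + 𝟙 R?
𝟙-⊎ split Q⇒P R⇒P Q⇒¬R P? (yes q) (yes r) = contradiction r (Q⇒¬R q)
𝟙-⊎ split Q⇒P R⇒P Q⇒¬R P? (yes q) (no _)  = 𝟙-yes P? (Q⇒P q)
𝟙-⊎ split Q⇒P R⇒P Q⇒¬R P? (no _)  (yes r) = 𝟙-yes P? (R⇒P r)
𝟙-⊎ split Q⇒P R⇒P Q⇒¬R (yes p) (no ¬q) (no ¬r) with split p
... | inj₁ q = contradiction q ¬q
... | inj₂ r = contradiction r ¬r
𝟙-⊎ split Q⇒P R⇒P Q⇒¬R (no _)  (no _)  (no _)  = refl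

count : ∀ {n} {P : Pred (Fin n) p} → Decidable P → ℕ
count P? = sum (λ v → 𝟙 (P? v))

sum-mono-≤ : ∀ {n} {f g : Fin n → ℕ} → (∀ i → f i ≤ g i) → sum f ≤ sum g
sum-mono-≤ {zero}  f≤g = z≤n
sum-mono-≤ {suc n} f≤g = +-mono-≤ (f≤g zero) (sum-mono-≤ (λ i → f≤g (suc i)))

sum-mono-< : ∀ {n} {f g : Fin n → ℕ} (j : Fin n) → (∀ i → f i ≤ g i) → f j < g j → sum f < sum g
sum-mono-< {suc n} {f} {g} j f≤g fj<gj = begin-strict
  sum f                           ≡⟨ sum-remove f ⟩
  f j + sum (f ∘ punchIn j)       <⟨ +-mono-<-≤ fj<gj (sum-mono-≤ (λ i → f≤g (punchIn j i))) ⟩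
  g j + sum (g ∘ punchIn j)       ≡⟨ sum-remove g ⟨
  sum g                           ∎
  where open ≤-Reasoning

sum-≤-length : ∀ {n} {f : Fin n → ℕ} → (∀ i → f i ≤ 1) → sum f ≤ n
sum-≤-length {zero}  f≤1 = z≤n
sum-≤-length {suc n} f≤1 = +-mono-≤ (f≤1 zero) (sum-≤-length (λ i → f≤1 (suc i)))

sum-const : ∀ n c → sum {n} (λ _ → c) ≡ n * c
sum-const zero    c = refl
sum-const (suc n) c = cong (c +_) (sum-const n c)

count-mono : ∀ {n} {P : Pred (Fin n) p} {Q : Pred (Fin n) q} (P? : Decidable P) (Q? : Decidable Q) →
             (∀ {v} → P v → Q v) → count P? ≤ count Q?
count-mono P? Q? P⊆Q = sum-mono-≤ (λ v → 𝟙-mono P⊆Q (P? v) (Q? v))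

count-cong : ∀ {n} {P : Pred (Fin n) p} {Q : Pred (Fin n) q} (P? : Decidable P) (Q? : Decidable Q) →
             (∀ {v} → P v → Q v) → (∀ {v} → Q v → P v) → count P? ≡ count Q?
count-cong P? Q? P⊆Q Q⊆P = ≤-antisym (count-mono P? Q? P⊆Q) (count-mono Q? P? Q⊆P)

count-mono-< : ∀ {n} {P : Pred (Fin n) p} {Q : Pred (Fin n) q} (P? : Decidable P) (Q? : Decidable Q) →
               (∀ {v} → P v → Q v) → ∀ {v} → Q v → ¬ P v → count P? < count Q?
count-mono-< {P = P} {Q = Q} P? Q? P⊆Q {v} qv ¬pv = sum-mono-< v (λ u → 𝟙-mono P⊆Q (P? u) (Q? u)) (lt (P? v) (Q? v))
  where
  lt : (P?v : Dec (P v)) (Q?v : Dec (Q v)) → 𝟙 P?v < 𝟙 Q?v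
  lt (yes pv) _        = contradiction pv ¬pv
  lt (no _)   (yes _)  = s≤s z≤n
  lt (no _)   (no ¬qv) = contradiction qv ¬qv

count≤n : ∀ {n} {P : Pred (Fin n) p} (P? : Decidable P) → count P? ≤ n
count≤n P? = sum-≤-length (λ v → 𝟙≤1 (P? v))

count-none : ∀ {n} {P : Pred (Fin n) p} (P? : Decidable P) → (∀ v → ¬ P v) → count P? ≡ 0
count-none {n = n} P? ¬P = trans (sum-cong-≗ (λ v → 𝟙-no (P? v) (¬P v))) (sum-replicate-zero n)

count-punchIn : ∀ {n} {P : Pred (Fin (suc n)) p} (P? : Decidable P) w → count P? ≡ 𝟙 (P? w) + count (λ i → P? (punchIn w i))
count-punchIn P? w = sum-remove (λ v → 𝟙 (P? v))

count-≟ : ∀ {n} (b : Fin n) → count (_≟ᶠ b) ≡ 1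
count-≟ {suc n} b = begin
  count (_≟ᶠ b)                                  ≡⟨ count-punchIn (_≟ᶠ b) b ⟩
  𝟙 (b ≟ᶠ b) + count (λ i → punchIn b i ≟ᶠ b)    ≡⟨ cong₂ _+_ (𝟙-yes (b ≟ᶠ b) refl) (count-none _ (punchInᵢ≢i b)) ⟩
  1                                              ∎
  where open ≡-Reasoning

count-⊎ : ∀ {n} {P : Pred (Fin n) p} {Q : Pred (Fin n) q} {R : Pred (Fin n) r}
            (P? : Decidable P) (Q? : Decidable Q) (R? : Decidable R) →
          (∀ {v} → P v → Q v ⊎ R v) → (∀ {v} → Q v → P v) → (∀ {v} → R v → P v) → (∀ {v} → Q v → ¬ R v) →
          count P? ≡ count Q? + count R?
count-⊎ P? Q? R? split Q⇒P R⇒P Q⇒¬R =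
  trans (sum-cong-≗ (λ v → 𝟙-⊎ split Q⇒P R⇒P Q⇒¬R (P? v) (Q? v) (R? v)))
        (∑-distrib-+ (λ v → 𝟙 (Q? v)) (λ v → 𝟙 (R? v)))

count-witness≢ : ∀ {n} {P : Pred (Fin n) p} (P? : Decidable P) → 2 ≤ count P? → ∀ q → ∃ λ y → P y × y ≢ q
count-witness≢ {P = P} P? 2≤#P q with any? (λ y → P? y ×-dec ¬? (y ≟ᶠ q))
... | yes witness = witness
... | no ¬witness = contradiction (≤-trans (count-mono P? (_≟ᶠ q) onlyq) (≤-reflexive (count-≟ q))) (<⇒≱ 2≤#P)
  where
  onlyq : ∀ {y} → P y → y ≡ q
  onlyq {y} py = decidable-stable (y ≟ᶠ q) (λ y≢q → ¬witness (y , py , y≢q))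

count≡2⇒≡⊎≡ : ∀ {n} {P : Pred (Fin n) p} (P? : Decidable P) → count P? ≡ 2 →
               ∀ {a b} → P a → P b → a ≢ b → ∀ {v} → P v → v ≡ a ⊎ v ≡ b
count≡2⇒≡⊎≡ P? #P≡2 {a} {b} pa pb a≢b {v} pv with v ≟ᶠ a | v ≟ᶠ b
... | yes v≡a | _       = inj₁ v≡a
... | no _    | yes v≡b = inj₂ v≡b
... | no v≢a  | no v≢b  = contradiction (subst₂ _<_ #a,b≡2 #P≡2 #a,b<#P) (<-irrefl refl)
  where
  a,b? : Decidable (λ u → u ≡ a ⊎ u ≡ b)
  a,b? u = (u ≟ᶠ a) ⊎-dec (u ≟ᶠ b)
  #a,b≡2 : count a,b? ≡ 2
  #a,b≡2 = trans (count-⊎ a,b? (_≟ᶠ a) (_≟ᶠ b) id inj₁ inj₂ (λ { refl refl → a≢b refl }))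
                 (cong₂ _+_ (count-≟ a) (count-≟ b))
  #a,b<#P : count a,b? < count P?
  #a,b<#P = count-mono-< a,b? P? (λ { (inj₁ refl) → pa ; (inj₂ refl) → pb }) pv (Data.Sum.[_,_] v≢a v≢b)

count-pos : ∀ {n} {P : Pred (Fin n) p} (P? : Decidable P) {v} → P v → 1 ≤ count P?
count-pos {n = suc n} P? {v} pv = ≤-trans (≤-reflexive (sym (𝟙-yes (P? v) pv)))
                                      (≤-trans (m≤m+n _ _) (≤-reflexive (sym (count-punchIn P? v))))

module _ {n : ℕ} where

  open import Data.List.Membership.DecPropositional (_≟ᶠ_ {n}) using (_∈?_)

  count-∈ : ∀ {xs : List (Fin n)} → Unique xs → count (_∈? xs) ≡ length xs
  count-∈ {xs = []}     _             = count-none (_∈? []) (λ _ ())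
  count-∈ {xs = x ∷ xs} (x∉xs ∷ uniq) =
    trans (count-⊎ (_∈? (x ∷ xs)) (_≟ᶠ x) (_∈? xs) split here there (λ { refl v∈xs → All-lookup x∉xs v∈xs refl }))
          (cong₂ _+_ (count-≟ x) (count-∈ uniq))
    where
    split : ∀ {v} → v ∈ x ∷ xs → v ≡ x ⊎ v ∈ xs
    split (here v≡x)  = inj₁ v≡x
    split (there v∈xs) = inj₂ v∈xs

  unique⇒length≤ : ∀ {xs : List (Fin n)} → Unique xs → length xs ≤ n
  unique⇒length≤ {xs = xs} uniq = ≤-trans (≤-reflexive (sym (count-∈ uniq))) (count≤n (_∈? xs))

module _ {a r} {A : Set a} {R : A → A → Set r} where

  AllPairs-++⁻ˡ : ∀ xs {ys} → AllPairs R (xs ++ ys) → AllPairs R xs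
  AllPairs-++⁻ˡ []       _          = []
  AllPairs-++⁻ˡ (x ∷ xs) (px ∷ pxs) = All.++⁻ˡ xs px ∷ AllPairs-++⁻ˡ xs pxs

  Linked-++⁻ˡ : ∀ xs {ys} → Linked R (xs ++ ys) → Linked R xs
  Linked-++⁻ˡ []           _         = []
  Linked-++⁻ˡ (x ∷ [])     _         = [-]
  Linked-++⁻ˡ (x ∷ y ∷ xs) (r ∷ rxs) = r ∷ Linked-++⁻ˡ (y ∷ xs) rxs

  Linked-∷ʳ : ∀ xs {y z} → Linked R (xs ++ [ y ]) → R y z → Linked R ((xs ++ [ y ]) ++ [ z ])
  Linked-∷ʳ []           _         ryz = ryz ∷ [-]
  Linked-∷ʳ (x ∷ [])     (r ∷ [-]) ryz = r ∷ ryz ∷ [-]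
  Linked-∷ʳ (x ∷ y ∷ xs) (r ∷ rxs) ryz = r ∷ Linked-∷ʳ (y ∷ xs) rxs ryz

module _ {a} {A : Set a} where

  unique-∷ʳ : ∀ (xs : List A) {x} → All (x ≢_) xs → Unique xs → Unique (xs ++ [ x ])
  unique-∷ʳ []       []            []           = [] ∷ []
  unique-∷ʳ (y ∷ ys) (x≢y ∷ x∉ys) (y∉ys ∷ uniq) = All.++⁺ y∉ys ((x≢y ∘ sym) ∷ []) ∷ unique-∷ʳ ys x∉ys uniq

  Linked-first : ∀ {r s} {R : A → A → Set r} {S : A → A → Set s} (xs : List A) → Linked (λ x y → R x y ⊎ S x y) xs →
                 Linked R xs ⊎ ∃ λ P → ∃ λ u → ∃ λ v → ∃ λ Q → xs ≡ P ++ u ∷ v ∷ Q × S u v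
  Linked-first []           _               = inj₁ []
  Linked-first (x ∷ [])     _               = inj₁ [-]
  Linked-first (x ∷ y ∷ xs) (inj₂ sxy ∷ _)  = inj₂ ([] , x , y , xs , refl , sxy)
  Linked-first (x ∷ y ∷ xs) (inj₁ rxy ∷ ls) with Linked-first (y ∷ xs) ls
  ... | inj₁ rs                          = inj₁ (rxy ∷ rs)
  ... | inj₂ (P , u , v , Q , eq , suv) = inj₂ (x ∷ P , u , v , Q , cong (x ∷_) eq , suv)

length-filter-partition : ∀ {a p} {A : Set a} {P : Pred A p} (P? : Decidable P) xs →
                          length (filter P? xs) + length (filter (∁? P?) xs) ≡ length xs
length-filter-partition P? []       = refl
length-filter-partition P? (x ∷ xs) with P? x
... | yes _ = cong suc (length-filter-partition P? xs)
... | no  _ = trans (+-suc _ _) (cong suc (length-filter-partition P? xs))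

module _ {a p} {A : Set a} {P : Pred A p} (P? : Decidable P) where

  private
    #allP : List (List A) → ℕ
    #allP Fs = length (filter (all? P?) Fs)

    #allP-∷-accept : ∀ {x} → P x → ∀ Fs → #allP (map (x ∷_) Fs) ≡ #allP Fs
    #allP-∷-accept px []       = refl
    #allP-∷-accept {x} px (F ∷ Fs) = step (all? P? F)
      where
      step : Dec (All P F) → #allP (map (x ∷_) (F ∷ Fs)) ≡ #allP (F ∷ Fs)
      step (yes allF) = begin
        #allP ((x ∷ F) ∷ map (x ∷_) Fs)   ≡⟨ cong length (filter-accept (all? P?) (px ∷ allF)) ⟩
        1 + #allP (map (x ∷_) Fs)         ≡⟨ cong (1 +_) (#allP-∷-accept px Fs) ⟩
        1 + #allP Fs                      ≡⟨ cong length (filter-accept (all? P?) allF) ⟨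
        #allP (F ∷ Fs)                    ∎
        where open ≡-Reasoning
      step (no ¬allF) = begin
        #allP ((x ∷ F) ∷ map (x ∷_) Fs)   ≡⟨ cong length (filter-reject (all? P?) {x ∷ F} {map (x ∷_) Fs} (¬allF ∘ tail)) ⟩
        #allP (map (x ∷_) Fs)             ≡⟨ #allP-∷-accept px Fs ⟩
        #allP Fs                          ≡⟨ cong length (filter-reject (all? P?) ¬allF) ⟨
        #allP (F ∷ Fs)                    ∎
        where open ≡-Reasoning

    #allP-∷-reject : ∀ {x} → ¬ P x → ∀ Fs → #allP (map (x ∷_) Fs) ≡ 0
    #allP-∷-reject ¬px Fs = cong length (filter-none (all? P?) (All.map⁺ (universal (λ { _ (px ∷ _) → ¬px px }) Fs)))

  length-filter-all-sublists : ∀ xs → length (filter (all? P?) (sublists xs)) ≡ 2 ^ length (filter P? xs)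
  length-filter-all-sublists []       = refl
  length-filter-all-sublists (x ∷ xs) = trans #sublists-∷ (extend (P? x))
    where
    open ≡-Reasoning
    #sublists-∷ : #allP (sublists (x ∷ xs)) ≡ #allP (sublists xs) + #allP (map (x ∷_) (sublists xs))
    #sublists-∷ = trans (cong length (filter-++ (all? P?) (sublists xs) _)) (length-++ (filter (all? P?) (sublists xs)))
    extend : (P?x : Dec (P x)) → #allP (sublists xs) + #allP (map (x ∷_) (sublists xs)) ≡ 2 ^ length (filter P? (x ∷ xs))
    extend (yes px) = begin
      #allP (sublists xs) + #allP (map (x ∷_) (sublists xs))   ≡⟨ cong (#allP (sublists xs) +_) (#allP-∷-accept px (sublists xs)) ⟩
      #allP (sublists xs) + #allP (sublists xs)                ≡⟨ cong (λ m → m + m) (length-filter-all-sublists xs) ⟩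
      2 ^ length (filter P? xs) + 2 ^ length (filter P? xs)    ≡⟨ cong (2 ^ length (filter P? xs) +_) (+-identityʳ _) ⟨
      2 ^ suc (length (filter P? xs))                          ≡⟨ cong (λ ys → 2 ^ length ys) (filter-accept P? px) ⟨
      2 ^ length (filter P? (x ∷ xs))                          ∎
    extend (no ¬px) = begin
      #allP (sublists xs) + #allP (map (x ∷_) (sublists xs))   ≡⟨ cong (#allP (sublists xs) +_) (#allP-∷-reject ¬px (sublists xs)) ⟩
      #allP (sublists xs) + 0                                  ≡⟨ +-identityʳ _ ⟩
      #allP (sublists xs)                                      ≡⟨ length-filter-all-sublists xs ⟩
      2 ^ length (filter P? xs)                                ≡⟨ cong (λ ys → 2 ^ length ys) (filter-reject P? ¬px) ⟨
      2 ^ length (filter P? (x ∷ xs))                          ∎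

module _ {n : ℕ} where

  _≟ₑ_ : DecidableEquality (Edge n)
  _≟ₑ_ = ≡-dec _≟ᶠ_ _≟ᶠ_

  open import Data.List.Membership.DecPropositional _≟ₑ_ using (_∈?_)

  Adj? : (E : List (Edge n)) → Decidable₂ (Adj E)
  Adj? E x y = ((x , y) ∈? E) ⊎-dec ((y , x) ∈? E)

  SameEdge? : Decidable₂ (SameEdge {n})
  SameEdge? (a , b) (c , d) = ((a ≟ᶠ c) ×-dec (b ≟ᶠ d)) ⊎-dec ((a ≟ᶠ d) ×-dec (b ≟ᶠ c))

Loopless : ∀ {n} → List (Edge n) → Set
Loopless E = All (λ { (a , b) → a ≢ b }) E

module _ {n : ℕ} {E : List (Edge n)} where

  Adj-sym : ∀ {x y} → Adj E x y → Adj E y x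
  Adj-sym (inj₁ xy∈E) = inj₂ xy∈E
  Adj-sym (inj₂ yx∈E) = inj₁ yx∈E

  Adj⇒≢ : Loopless E → ∀ {x y} → Adj E x y → x ≢ y
  Adj⇒≢ loopless (inj₁ xy∈E) x≡y = All-lookup loopless xy∈E x≡y
  Adj⇒≢ loopless (inj₂ yx∈E) x≡y = All-lookup loopless yx∈E (sym x≡y)

  deg-∈ : ∀ {u e} → e ∈ E → Incident u e → 1 ≤ deg E u
  deg-∈ {u} e∈E inc = filter-some (incident? u) (lose e∈E inc)

  Adj⇒deg-pos : ∀ {x y} → Adj E x y → 1 ≤ deg E x
  Adj⇒deg-pos (inj₁ xy∈E) = deg-∈ xy∈E (inj₁ refl)
  Adj⇒deg-pos (inj₂ yx∈E) = deg-∈ yx∈E (inj₂ refl)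

  deg-pos⇒incident : ∀ {u} → 1 ≤ deg E u → ∃[ e ] e ∈ E × Incident u e
  deg-pos⇒incident {u} 1≤deg with filter (incident? u) E in eq
  ... | e ∷ _ = e , ∈-filter⁻ (incident? u) (subst (e ∈_) (sym eq) (here refl))

connected⇒deg-pos : ∀ {n} {E : List (Edge n)} → Connected E → ∀ {v₀} → 1 ≤ deg E v₀ → ∀ v → 1 ≤ deg E v
connected⇒deg-pos connected {v₀} 1≤deg-v₀ v with connected v v₀
... | ε         = 1≤deg-v₀
... | v~y ◅ _   = Adj⇒deg-pos v~y

deg-∷ : ∀ {n} (e : Edge n) E u → deg (e ∷ E) u ≡ 𝟙 (incident? u e) + deg E u
deg-∷ e E u with incident? u e
... | yes inc = cong length (filter-accept (incident? u) inc)
... | no ¬inc = cong length (filter-reject (incident? u) ¬inc)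

module _ {n : ℕ} {a b : Fin n} (a≢b : a ≢ b) where

  count-incident : count (λ u → incident? u (a , b)) ≡ 2
  count-incident = trans (count-⊎ (λ u → incident? u (a , b)) (_≟ᶠ a) (_≟ᶠ b) id inj₁ inj₂ (λ { refl refl → a≢b refl }))
                         (cong₂ _+_ (count-≟ a) (count-≟ b))

  private
    partner-of-a : ∀ {v} → SameEdge (a , v) (a , b) → v ≡ b
    partner-of-a (inj₁ (_ , v≡b)) = v≡b
    partner-of-a (inj₂ (a≡b , _)) = contradiction a≡b a≢b

    partner-of-b : ∀ {v} → SameEdge (b , v) (a , b) → v ≡ a
    partner-of-b (inj₁ (b≡a , _)) = contradiction (sym b≡a) a≢b
    partner-of-b (inj₂ (_ , v≡a)) = v≡a

    SameEdge⇒incident : ∀ {u v} → SameEdge (u , v) (a , b) → Incident u (a , b)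
    SameEdge⇒incident (inj₁ (u≡a , _)) = inj₁ u≡a
    SameEdge⇒incident (inj₂ (u≡b , _)) = inj₂ u≡b

  count-SameEdge : ∀ u → count (λ v → SameEdge? (u , v) (a , b)) ≡ 𝟙 (incident? u (a , b))
  count-SameEdge u with incident? u (a , b)
  ... | yes (inj₁ refl) =
    trans (count-cong (λ v → SameEdge? (a , v) (a , b)) (_≟ᶠ b) partner-of-a λ { refl → inj₁ (refl , refl) }) (count-≟ b)
  ... | yes (inj₂ refl) =
    trans (count-cong (λ v → SameEdge? (b , v) (a , b)) (_≟ᶠ a) partner-of-b λ { refl → inj₂ (refl , refl) }) (count-≟ a)
  ... | no ¬inc = count-none (λ v → SameEdge? (u , v) (a , b)) (λ _ → ¬inc ∘ SameEdge⇒incident)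

deg≡#neighbours : ∀ {n} (E : List (Edge n)) → Simple E → ∀ u → deg E u ≡ count (Adj? E u)
deg≡#neighbours [] _ u = sym (count-none (Adj? [] u) λ { v (inj₁ ()) ; v (inj₂ ()) })
deg≡#neighbours ((a , b) ∷ E) (a≢b ∷ loopless , distinct ∷ pairs) u = begin
  deg ((a , b) ∷ E) u
    ≡⟨ deg-∷ (a , b) E u ⟩
  𝟙 (incident? u (a , b)) + deg E u
    ≡⟨ cong₂ _+_ (sym (count-SameEdge a≢b u)) (deg≡#neighbours E (loopless , pairs) u) ⟩
  count (λ v → SameEdge? (u , v) (a , b)) + count (Adj? E u)
    ≡⟨ count-⊎ (Adj? ((a , b) ∷ E) u) (λ v → SameEdge? (u , v) (a , b)) (Adj? E u) split new old disjoint ⟨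
  count (Adj? ((a , b) ∷ E) u)
    ∎
  where
  open ≡-Reasoning
  split : ∀ {v} → Adj ((a , b) ∷ E) u v → SameEdge (u , v) (a , b) ⊎ Adj E u v
  split (inj₁ (here refl))  = inj₁ (inj₁ (refl , refl))
  split (inj₂ (here refl))  = inj₁ (inj₂ (refl , refl))
  split (inj₁ (there uv∈E)) = inj₂ (inj₁ uv∈E)
  split (inj₂ (there vu∈E)) = inj₂ (inj₂ vu∈E)
  new : ∀ {v} → SameEdge (u , v) (a , b) → Adj ((a , b) ∷ E) u v
  new (inj₁ (refl , refl)) = inj₁ (here refl)
  new (inj₂ (refl , refl)) = inj₂ (here refl)
  old : ∀ {v} → Adj E u v → Adj ((a , b) ∷ E) u v
  old (inj₁ uv∈E) = inj₁ (there uv∈E)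
  old (inj₂ vu∈E) = inj₂ (there vu∈E)
  disjoint : ∀ {v} → SameEdge (u , v) (a , b) → ¬ Adj E u v
  disjoint (inj₁ (refl , refl)) (inj₁ ab∈E) = All-lookup distinct ab∈E (inj₁ (refl , refl))
  disjoint (inj₁ (refl , refl)) (inj₂ ba∈E) = All-lookup distinct ba∈E (inj₂ (refl , refl))
  disjoint (inj₂ (refl , refl)) (inj₁ ba∈E) = All-lookup distinct ba∈E (inj₂ (refl , refl))
  disjoint (inj₂ (refl , refl)) (inj₂ ab∈E) = All-lookup distinct ab∈E (inj₁ (refl , refl))

handshake : ∀ {n} (E : List (Edge n)) → Loopless E → sum (deg E) ≡ 2 * length E
handshake {n} [] _ = sum-replicate-zero n
handshake ((a , b) ∷ E) (a≢b ∷ loopless) = begin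
  sum (deg ((a , b) ∷ E))                                          ≡⟨ sum-cong-≗ (deg-∷ (a , b) E) ⟩
  sum (λ u → 𝟙 (incident? u (a , b)) + deg E u)                    ≡⟨ ∑-distrib-+ (λ u → 𝟙 (incident? u (a , b))) (deg E) ⟩
  count (λ u → incident? u (a , b)) + sum (deg E)                  ≡⟨ cong₂ _+_ (count-incident a≢b) (handshake E loopless) ⟩
  2 + 2 * length E                                                 ≡⟨ *-suc 2 (length E) ⟨
  2 * length ((a , b) ∷ E)                                         ∎
  where open ≡-Reasoning

module _ {n : ℕ} (E : List (Edge n)) where

  Good : Edge n → Set
  Good (a , b) = 3 ≤ deg E a × 3 ≤ deg E b

  Good? : Decidable Good
  Good? (a , b) = (3 ≤? deg E a) ×-dec (3 ≤? deg E b)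

  pure⇒good : ∀ {F} → Pure E F → All Good F
  pure⇒good {F} pure = tabulate λ { {a , b} ab∈F → big (deg-∈ ab∈F (inj₁ refl)) , big (deg-∈ ab∈F (inj₂ refl)) }
    where
    big : ∀ {u} → 1 ≤ deg F u → 3 ≤ deg E u
    big {u} 1≤degF = ≤-trans (s≤s (*-monoʳ-≤ 2 1≤degF)) (pure u)

  numPure≤2^#good : numPure E ≤ 2 ^ length (filter Good? E)
  numPure≤2^#good = begin
    numPure E
      ≤⟨ length-mono-≤ (filter⁺ (pure? E) (all? Good?) (λ { refl → pure⇒good }) (⊆-refl {x = sublists E})) ⟩
    length (filter (all? Good?) (sublists E))      ≡⟨ length-filter-all-sublists Good? E ⟩
    2 ^ length (filter Good? E)                    ∎
    where open ≤-Reasoning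

  good-edge-endpoint : ∀ {v} → 1 ≤ deg (filter Good? E) v → 3 ≤ deg E v
  good-edge-endpoint 1≤deg with deg-pos⇒incident {E = filter Good? E} 1≤deg
  ... | e , e∈good , inj₁ refl = proj₁ (proj₂ (∈-filter⁻ Good? {xs = E} e∈good))
  ... | e , e∈good , inj₂ refl = proj₂ (proj₂ (∈-filter⁻ Good? {xs = E} e∈good))

module _ {n : ℕ} {E : List (Edge n)} where

  path⇒cycle : ∀ {x q qs y} → Unique (x ∷ q ∷ qs ++ [ y ]) → Linked (Adj E) (x ∷ q ∷ qs ++ [ y ]) → Adj E y x →
               IsCycle E (x ∷ q ∷ qs ++ [ y ])
  path⇒cycle {x} {q} {qs} {y} uniq linked y~x =
    s≤s (s≤s (subst (1 ≤_) (sym (length-++ qs)) (m≤n+m 1 (length qs)))) , uniq , Linked-∷ʳ (x ∷ q ∷ qs) linked y~x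

  acyclic-mono : ∀ {G : List (Edge n)} → (∀ {x y} → Adj G x y → Adj E x y) → Acyclic E → Acyclic G
  acyclic-mono G⊆E acyclic []       ()
  acyclic-mono G⊆E acyclic (x ∷ xs) (3≤len , uniq , linked) = acyclic (x ∷ xs) (3≤len , uniq , Linked.map G⊆E linked)

module _ {n : ℕ} {G : List (Edge n)} (simple : Simple G) (acyclic : Acyclic G) where

  open import Data.List.Membership.DecPropositional (_≟ᶠ_ {n}) using (_∈?_)

  other-neighbour : ∀ {e q} → Adj G e q → deg G e ≢ 1 → ∃ λ y → Adj G e y × y ≢ q
  other-neighbour {e} {q} e~q deg≢1 = count-witness≢ (Adj? G e) 2≤#neighbours q
    where
    2≤#neighbours : 2 ≤ count (Adj? G e)
    2≤#neighbours = subst (2 ≤_) (deg≡#neighbours G simple e) (≤∧≢⇒< (Adj⇒deg-pos e~q) (deg≢1 ∘ sym))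

  -- The path e ∷ q ∷ rest is extended at e until e is a leaf; acyclicity keeps it a path, so it cannot outgrow n.
  path⇒leaf : ∀ fuel {e q rest} → Unique (e ∷ q ∷ rest) → Linked (Adj G) (e ∷ q ∷ rest) →
              n < fuel + length (e ∷ q ∷ rest) → ∃ λ v → deg G v ≡ 1
  path⇒leaf zero uniq _ n<len = contradiction (unique⇒length≤ uniq) (<⇒≱ n<len)
  path⇒leaf (suc fuel) {e} {q} {rest} uniq linked@(e~q ∷ _) n<len with deg G e ≟ 1
  ... | yes leaf = e , leaf
  ... | no ¬leaf with other-neighbour e~q ¬leaf
  ... | y , e~y , y≢q with y ∈? (e ∷ q ∷ rest)
  ... | no y∉path = path⇒leaf fuel (All.¬Any⇒All¬ _ y∉path ∷ uniq) (Adj-sym e~y ∷ linked) (subst (n <_) (sym (+-suc fuel _)) n<len)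
  ... | yes (here y≡e)            = contradiction (sym y≡e) (Adj⇒≢ (proj₁ simple) e~y)
  ... | yes (there (here y≡q))    = contradiction y≡q y≢q
  ... | yes (there (there y∈rest)) with ∈-∃++ y∈rest
  ... | r₁ , r₂ , refl = ⊥-elim (acyclic (e ∷ q ∷ r₁ ++ [ y ]) (path⇒cycle (AllPairs-++⁻ˡ (e ∷ q ∷ r₁ ++ [ y ]) uniq′)
                                                               (Linked-++⁻ˡ (e ∷ q ∷ r₁ ++ [ y ]) linked′) (Adj-sym e~y)))
    where
    path≡ : e ∷ q ∷ r₁ ++ y ∷ r₂ ≡ (e ∷ q ∷ r₁ ++ [ y ]) ++ r₂
    path≡ = cong (λ t → e ∷ q ∷ t) (sym (++-assoc r₁ [ y ] r₂))
    uniq′ : Unique ((e ∷ q ∷ r₁ ++ [ y ]) ++ r₂)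
    uniq′ = subst Unique path≡ uniq
    linked′ : Linked (Adj G) ((e ∷ q ∷ r₁ ++ [ y ]) ++ r₂)
    linked′ = subst (Linked (Adj G)) path≡ linked

  ∃-leaf : ∀ {a b} → Adj G a b → ∃ λ v → deg G v ≡ 1
  ∃-leaf a~b = path⇒leaf n (((Adj⇒≢ (proj₁ simple) a~b) ∷ []) ∷ [] ∷ []) (a~b ∷ [-]) (m<m+n n z<s)

nonIsolated : ∀ {n} → List (Edge n) → ℕ
nonIsolated G = count (λ v → 1 ≤? deg G v)

deg-mono : ∀ {n} {G H : List (Edge n)} → G ⊆ H → ∀ u → deg G u ≤ deg H u
deg-mono G⊆H u = length-mono-≤ (filter⁺ (incident? u) (incident? u) (λ { refl inc → inc }) G⊆H)

2≤nonIsolated : ∀ {n} {G : List (Edge n)} → Loopless G → ∀ {a b} → (a , b) ∈ G → 2 ≤ nonIsolated G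
2≤nonIsolated {G = G} loopless {a} {b} ab∈G =
  subst (_≤ nonIsolated G) (count-incident (Adj⇒≢ loopless (inj₁ ab∈G)))
        (count-mono (λ u → incident? u (a , b)) (λ v → 1 ≤? deg G v) (deg-∈ ab∈G))

deleteVertex : ∀ {n} → Fin n → List (Edge n) → List (Edge n)
deleteVertex v = filter (∁? (incident? v))

module _ {n : ℕ} (G : List (Edge n)) (v : Fin n) (leaf : deg G v ≡ 1) where

  length-deleteLeaf : length G ≡ suc (length (deleteVertex v G))
  length-deleteLeaf = trans (sym (length-filter-partition (incident? v) G)) (cong (_+ length (deleteVertex v G)) leaf)

  nonIsolated-deleteLeaf : nonIsolated (deleteVertex v G) < nonIsolated G
  nonIsolated-deleteLeaf = count-mono-< (λ u → 1 ≤? deg (deleteVertex v G) u) (λ u → 1 ≤? deg G u)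
                             (λ {u} 1≤deg → ≤-trans 1≤deg (deg-mono (filter-⊆ _ G) u))
                             (≤-reflexive (sym leaf)) (<⇒≱ (s≤s (≤-reflexive isolated)))
    where
    isolated : deg (deleteVertex v G) v ≡ 0
    isolated = cong length (filter-none (incident? v) (All.all-filter (∁? (incident? v)) G))

module _ {n : ℕ} {G : List (Edge n)} {p} {P : Pred (Edge n) p} (P? : Decidable P) where

  simple-filter : Simple G → Simple (filter P? G)
  simple-filter (loopless , distinct) = All.filter⁺ P? loopless , AllPairs.filter⁺ P? distinct

  acyclic-filter : Acyclic G → Acyclic (filter P? G)
  acyclic-filter = acyclic-mono (Data.Sum.map (proj₁ ∘ ∈-filter⁻ P?) (proj₁ ∘ ∈-filter⁻ P?))

-- Removing a leaf loses one edge and at least one non-isolated vertex; when no edge is left, the last edge has two endpoints.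
acyclic⇒edges<nonIsolated : ∀ {n} (G : List (Edge n)) → Simple G → Acyclic G → G ≡ [] ⊎ length G < nonIsolated G
acyclic⇒edges<nonIsolated G simple acyclic = go G simple acyclic (<-wellFounded (length G))
  where
  go : ∀ {n} (G : List (Edge n)) → Simple G → Acyclic G → Acc _<_ (length G) → G ≡ [] ⊎ length G < nonIsolated G
  go []              _      _       _         = inj₁ refl
  go G@((a , b) ∷ _) simple acyclic (acc rec) with ∃-leaf simple acyclic (inj₁ (here refl))
  ... | v , leaf with go (deleteVertex v G) (simple-filter (∁? (incident? v)) simple) (acyclic-filter (∁? (incident? v)) acyclic)
                         (rec (≤-reflexive (sym (length-deleteLeaf G v leaf))))
  ... | inj₁ G-v≡[] = inj₂ (subst (_< nonIsolated G) (sym (trans (length-deleteLeaf G v leaf) (cong (suc ∘ length) G-v≡[])))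
                                  (2≤nonIsolated (proj₁ simple) (here refl)))
  ... | inj₂ G-v<    = inj₂ (subst (_< nonIsolated G) (sym (length-deleteLeaf G v leaf))
                                  (≤-trans (s≤s G-v<) (nonIsolated-deleteLeaf G v leaf)))

module _ {n : ℕ} {E : List (Edge n)} where

  rotate-cycle : ∀ {x y ys} → IsCycle E (x ∷ y ∷ ys) → IsCycle E (y ∷ ys ++ [ x ])
  rotate-cycle {x} {y} {ys} (3≤len , x∉ ∷ uniq , x~y ∷ linked) =
    subst (3 ≤_) length-rotate 3≤len , unique-∷ʳ (y ∷ ys) x∉ uniq , Linked-∷ʳ (y ∷ ys) linked x~y
    where
    length-rotate : length (x ∷ y ∷ ys) ≡ length (y ∷ ys ++ [ x ])
    length-rotate = cong suc (trans (+-comm 1 (length ys)) (sym (length-++ ys)))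

  rotate-cycle-to : ∀ P {x xs u v Q} → IsCycle E (x ∷ xs) → (x ∷ xs) ++ [ x ] ≡ P ++ u ∷ v ∷ Q →
                    ∃ λ M → IsCycle E (u ∷ v ∷ M)
  rotate-cycle-to _ {xs = []} (s≤s () , _) _
  rotate-cycle-to [] {xs = y ∷ ys} cycle refl = ys , cycle
  rotate-cycle-to (_ ∷ P) {x} {y ∷ ys} {Q = Q} cycle closed≡ =
    rotate-cycle-to P (rotate-cycle cycle) (begin
      (y ∷ ys ++ [ x ]) ++ [ y ]         ≡⟨ cong (_++ [ y ]) (∷-injectiveʳ closed≡) ⟩
      (P ++ _ ∷ _ ∷ Q) ++ [ y ]          ≡⟨ ++-assoc P _ [ y ] ⟩
      P ++ _ ∷ _ ∷ Q ++ [ y ]            ∎)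
    where open ≡-Reasoning

module _ {n : ℕ} where

  SameEdge-sym : ∀ {e f : Edge n} → SameEdge e f → SameEdge f e
  SameEdge-sym (inj₁ (refl , refl)) = inj₁ (refl , refl)
  SameEdge-sym (inj₂ (refl , refl)) = inj₂ (refl , refl)

  SameEdge-trans : ∀ {e f g : Edge n} → SameEdge e f → SameEdge f g → SameEdge e g
  SameEdge-trans (inj₁ (refl , refl)) fg                   = fg
  SameEdge-trans (inj₂ (refl , refl)) (inj₁ (refl , refl)) = inj₂ (refl , refl)
  SameEdge-trans (inj₂ (refl , refl)) (inj₂ (refl , refl)) = inj₁ (refl , refl)

  Linked-avoid : ∀ {r} {R : Fin n → Fin n → Set r} {u v m M} → Unique (u ∷ v ∷ m ∷ M) →
                 Linked (λ s t → R s t ⊎ SameEdge (s , t) (u , v)) (v ∷ m ∷ M ++ [ u ]) → Linked R (v ∷ m ∷ M ++ [ u ])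
  Linked-avoid {R = R} {u} {v} ((u≢v ∷ u∉@(u≢m ∷ _)) ∷ v∉ ∷ _) (v~m ∷ linked) =
    first v~m u≢m ∷ rest _ (zip (u∉ , v∉)) linked
    where
    first : ∀ {m} → R v m ⊎ SameEdge (v , m) (u , v) → u ≢ m → R v m
    first (inj₁ rvm)               _   = rvm
    first (inj₂ (inj₁ (v≡u , _))) _   = contradiction (sym v≡u) u≢v
    first (inj₂ (inj₂ (_ , m≡u))) u≢m = contradiction (sym m≡u) u≢m
    old : ∀ {s t} → u ≢ s × v ≢ s → R s t ⊎ SameEdge (s , t) (u , v) → R s t
    old _           (inj₁ rst)               = rst
    old (u≢s , _)   (inj₂ (inj₁ (s≡u , _))) = contradiction (sym s≡u) u≢s
    old (_ , v≢s)   (inj₂ (inj₂ (s≡v , _))) = contradiction (sym s≡v) v≢s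
    rest : ∀ {s} ss → All (λ x → u ≢ x × v ≢ x) (s ∷ ss) →
           Linked (λ s t → R s t ⊎ SameEdge (s , t) (u , v)) (s ∷ ss ++ [ u ]) → Linked R (s ∷ ss ++ [ u ])
    rest []       (fresh ∷ _)      (step ∷ [-])    = old fresh step ∷ [-]
    rest (_ ∷ ss) (fresh ∷ freshs) (step ∷ linked) = old fresh step ∷ rest ss freshs linked

#deg≢2 : ∀ {n} → List (Edge n) → ℕ
#deg≢2 E = count (λ v → ¬? (deg E v ≟ 2))

module SmoothingStep {n : ℕ} {E : List (Edge (suc n))} {E′ : List (Edge n)} (simple : Simple E) (acyclic : Acyclic E)
  {w a b : Fin (suc n)} (deg-w : deg E w ≡ 2) (w~a : Adj E w a) (w~b : Adj E w b) (a≢b : a ≢ b) (simple′ : Simple E′)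
  (adj′ : (x y : Fin n) → Adj E′ x y ⇔ (Adj E (punchIn w x) (punchIn w y) ⊎ SameEdge (punchIn w x , punchIn w y) (a , b)))
  where

  private
    ι : Fin n → Fin (suc n)
    ι = punchIn w

    ι-injective : ∀ {s t} → ι s ≡ ι t → s ≡ t
    ι-injective = punchIn-injective w _ _

    w≢a : w ≢ a
    w≢a = Adj⇒≢ (proj₁ simple) w~a

    w≢b : w ≢ b
    w≢b = Adj⇒≢ (proj₁ simple) w~b

    Old New : Fin n → Fin n → Set
    Old s t = Adj E (ι s) (ι t)
    New s t = SameEdge (ι s , ι t) (a , b)

    old⊎new : ∀ {s t} → Adj E′ s t → Old s t ⊎ New s t
    old⊎new {s} {t} = Equivalence.to (adj′ s t)

  neighbours-w : ∀ {v} → Adj E w v → v ≡ a ⊎ v ≡ b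
  neighbours-w = count≡2⇒≡⊎≡ (Adj? E w) (trans (sym (deg≡#neighbours E simple w)) deg-w) w~a w~b a≢b

  a≁b : ¬ Adj E a b
  a≁b a~b = acyclic (w ∷ a ∷ [] ++ [ b ])
                    (path⇒cycle {qs = []} ((w≢a ∷ w≢b ∷ []) ∷ (a≢b ∷ []) ∷ [] ∷ []) (w~a ∷ a~b ∷ [-]) (Adj-sym w~b))

  new⇒w-adjacent : ∀ {s t} → SameEdge (s , t) (a , b) → Adj E w s × Adj E w t
  new⇒w-adjacent (inj₁ (refl , refl)) = w~a , w~b
  new⇒w-adjacent (inj₂ (refl , refl)) = w~b , w~a

  new-neighbours : ∀ x → count (λ y → SameEdge? (ι x , ι y) (a , b)) ≡ 𝟙 (Adj? E (ι x) w)
  new-neighbours x = begin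
    count new?                                          ≡⟨ cong (_+ count new?) w-not-new ⟨
    𝟙 (SameEdge? (ι x , w) (a , b)) + count new?        ≡⟨ count-punchIn (λ v → SameEdge? (ι x , v) (a , b)) w ⟨
    count (λ v → SameEdge? (ι x , v) (a , b))           ≡⟨ count-SameEdge a≢b (ι x) ⟩
    𝟙 (incident? (ι x) (a , b))                         ≡⟨ 𝟙-cong incident⇒adjacent (neighbours-w ∘ Adj-sym) _ _ ⟩
    𝟙 (Adj? E (ι x) w)                                  ∎
    where
    open ≡-Reasoning
    new? : Decidable (New x)
    new? y = SameEdge? (ι x , ι y) (a , b)
    w-not-new : 𝟙 (SameEdge? (ι x , w) (a , b)) ≡ 0
    w-not-new = 𝟙-no (SameEdge? (ι x , w) (a , b)) λ { (inj₁ (_ , w≡b)) → w≢b w≡b ; (inj₂ (_ , w≡a)) → w≢a w≡a }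
    incident⇒adjacent : Incident (ι x) (a , b) → Adj E (ι x) w
    incident⇒adjacent (inj₁ refl) = Adj-sym w~a
    incident⇒adjacent (inj₂ refl) = Adj-sym w~b

  deg-smooth : ∀ x → deg E′ x ≡ deg E (ι x)
  deg-smooth x = begin
    deg E′ x                                                        ≡⟨ deg≡#neighbours E′ simple′ x ⟩
    count (Adj? E′ x)                                               ≡⟨ count-⊎ (Adj? E′ x) old? new? old⊎new
                                                                                 (Equivalence.from (adj′ x _) ∘ inj₁)
                                                                                 (Equivalence.from (adj′ x _) ∘ inj₂) old⇒¬new ⟩
    count old? + count new?                                         ≡⟨ cong (count old? +_) (new-neighbours x) ⟩
    count old? + 𝟙 (Adj? E (ι x) w)                                 ≡⟨ +-comm (count old?) _ ⟩
    𝟙 (Adj? E (ι x) w) + count old?                                 ≡⟨ count-punchIn (Adj? E (ι x)) w ⟨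
    count (Adj? E (ι x))                                            ≡⟨ deg≡#neighbours E simple (ι x) ⟨
    deg E (ι x)                                                     ∎
    where
    open ≡-Reasoning
    old? : Decidable (Old x)
    old? y = Adj? E (ι x) (ι y)
    new? : Decidable (New x)
    new? y = SameEdge? (ι x , ι y) (a , b)
    old⇒¬new : ∀ {y} → Old x y → ¬ New x y
    old⇒¬new a~b (inj₁ (refl , refl)) = a≁b a~b
    old⇒¬new b~a (inj₂ (refl , refl)) = a≁b (Adj-sym b~a)

  #deg≢2-smooth : #deg≢2 E′ ≡ #deg≢2 E
  #deg≢2-smooth = begin
    #deg≢2 E′                   ≡⟨ count-cong (λ x → ¬? (deg E′ x ≟ 2)) ≢2∘ι? (λ {x} ≢2 → ≢2 ∘ trans (deg-smooth x))
                                                                          (λ {x} ≢2 → ≢2 ∘ trans (sym (deg-smooth x))) ⟩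
    count ≢2∘ι?                 ≡⟨ cong (_+ count ≢2∘ι?) (𝟙-no (¬? (deg E w ≟ 2)) (λ ≢2 → ≢2 deg-w)) ⟨
    𝟙 (¬? (deg E w ≟ 2)) + count ≢2∘ι?
                                ≡⟨ count-punchIn (λ v → ¬? (deg E v ≟ 2)) w ⟨
    #deg≢2 E                    ∎
    where
    open ≡-Reasoning
    ≢2∘ι? : Decidable (λ x → deg E (ι x) ≢ 2)
    ≢2∘ι? x = ¬? (deg E (ι x) ≟ 2)

  private
    ι-SameEdge⁻ : ∀ {s t u v} → SameEdge (ι s , ι t) (ι u , ι v) → SameEdge (s , t) (u , v)
    ι-SameEdge⁻ (inj₁ (s≡u , t≡v)) = inj₁ (ι-injective s≡u , ι-injective t≡v)
    ι-SameEdge⁻ (inj₂ (s≡v , t≡u)) = inj₂ (ι-injective s≡v , ι-injective t≡u)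

    w∉ι : ∀ xs → All (w ≢_) (map ι xs)
    w∉ι xs = All.map⁺ (universal (λ x w≡ιx → punchInᵢ≢i w x (sym w≡ιx)) xs)

  cycle-avoiding-w : ∀ {x xs} → IsCycle E′ (x ∷ xs) → Linked Old ((x ∷ xs) ++ [ x ]) → IsCycle E (map ι (x ∷ xs))
  cycle-avoiding-w {x} {xs} (3≤len , uniq , _) old =
    subst (3 ≤_) (sym (length-map ι (x ∷ xs))) 3≤len ,
    Unique.map⁺ ι-injective uniq ,
    subst (Linked (Adj E)) (map-++ ι (x ∷ xs) [ x ]) (Linked.map⁺ old)

  -- Rotated so that the new edge u—v closes the cycle, the rest of the cycle consists of old edges; w re-subdivides u—v.
  cycle-through-w : ∀ {u v m M} → New u v → IsCycle E′ (u ∷ v ∷ m ∷ M) → IsCycle E (w ∷ ι v ∷ map ι (m ∷ M) ++ [ ι u ])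
  cycle-through-w {u} {v} {m} {M} new (_ , uniq@(u∉ ∷ uniq-path) , _ ∷ linked) =
    path⇒cycle {qs = map ι (m ∷ M)}
               (subst Unique (cong (w ∷_) ι-path) (w∉ι (v ∷ m ∷ M ++ [ u ]) ∷ Unique.map⁺ ι-injective unique-path))
               (proj₂ (new⇒w-adjacent new) ∷ subst (Linked (Adj E)) ι-path (Linked.map⁺ old-path))
               (Adj-sym (proj₁ (new⇒w-adjacent new)))
    where
    ι-path : map ι (v ∷ m ∷ M ++ [ u ]) ≡ ι v ∷ map ι (m ∷ M) ++ [ ι u ]
    ι-path = cong (ι v ∷_) (map-++ ι (m ∷ M) [ u ])
    unique-path : Unique (v ∷ m ∷ M ++ [ u ])
    unique-path = unique-∷ʳ (v ∷ m ∷ M) u∉ uniq-path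
    new⇒same-as-uv : ∀ {s t} → New s t → SameEdge (s , t) (u , v)
    new⇒same-as-uv new-st = ι-SameEdge⁻ (SameEdge-trans new-st (SameEdge-sym new))
    old-path : Linked Old (v ∷ m ∷ M ++ [ u ])
    old-path = Linked-avoid uniq (Linked.map (Data.Sum.map₂ new⇒same-as-uv ∘ old⊎new) linked)

  acyclic-smooth : Acyclic E′
  acyclic-smooth []       ()
  acyclic-smooth (x ∷ xs) cycle@(_ , _ , linked) with Linked-first ((x ∷ xs) ++ [ x ]) (Linked.map old⊎new linked)
  ... | inj₁ old = acyclic (map ι (x ∷ xs)) (cycle-avoiding-w cycle old)
  ... | inj₂ (P , u , v , Q , closed≡ , new) with rotate-cycle-to P cycle closed≡
  ... | []    , (s≤s (s≤s ()) , _)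
  ... | m ∷ M , cycle′ = acyclic (w ∷ ι v ∷ map ι (m ∷ M) ++ [ ι u ]) (cycle-through-w new cycle′)

smooth-step : ∀ {n m} {E : List (Edge n)} {E′ : List (Edge m)} → Smooth (n , E) (m , E′) → Simple E × Acyclic E →
              (Simple E′ × Acyclic E′) × #deg≢2 E′ ≡ #deg≢2 E
smooth-step {zero} ()
smooth-step {suc n} (refl , w , a , b , deg-w , w~a , w~b , a≢b , simple′ , adj′) (simple , acyclic) =
  (simple′ , Step.acyclic-smooth) , Step.#deg≢2-smooth
  where module Step = SmoothingStep simple acyclic deg-w w~a w~b a≢b simple′ adj′

#deg≢2-smoothing : ∀ {n m} {E : List (Edge n)} {E′ : List (Edge m)} → Star Smooth (n , E) (m , E′) → Simple E × Acyclic E →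
                   #deg≢2 E′ ≡ #deg≢2 E
#deg≢2-smoothing ε            _      = refl
#deg≢2-smoothing (step ◅ steps) forest with smooth-step step forest
... | forest′ , #≡ = trans (#deg≢2-smoothing steps forest′) #≡

deg-contribution : ∀ {δ} d → 1 ≤ d → (3 ≤ d → δ ≤ d) → 𝟙 (3 ≤? d) * (δ ∸ 1) + 2 ≤ 𝟙 (¬? (d ≟ 2)) + d
deg-contribution 1 _ _ = ≤-refl
deg-contribution 2 _ _ = ≤-refl
deg-contribution {δ} d@(suc (suc (suc d′))) _ δ≤d = begin
  1 * (δ ∸ 1) + 2   ≡⟨ cong (_+ 2) (*-identityˡ (δ ∸ 1)) ⟩
  δ ∸ 1 + 2         ≤⟨ +-monoˡ-≤ 2 (∸-monoˡ-≤ 1 (δ≤d (s≤s (s≤s (s≤s z≤n))))) ⟩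
  suc (suc d′) + 2  ≡⟨ +-comm (suc (suc d′)) 2 ⟩
  1 + d             ∎
  where open ≤-Reasoning

^-*-suc : ∀ b m e → (b ^ m) ^ e * b ^ e ≡ b ^ (suc m * e)
^-*-suc b m e = begin
  (b ^ m) ^ e * b ^ e   ≡⟨ cong (_* b ^ e) (^-*-assoc b m e) ⟩
  b ^ (m * e) * b ^ e   ≡⟨ ^-distribˡ-+-* b (m * e) e ⟨
  b ^ (m * e + e)       ≡⟨ cong (b ^_) (+-comm (m * e) e) ⟩
  b ^ (suc m * e)       ∎
  where open ≡-Reasoning

#deg≥3 : ∀ {n} → List (Edge n) → ℕ
#deg≥3 E = count (λ v → 3 ≤? deg E v)

module _ {n : ℕ} {E : List (Edge n)} (simple : Simple E) (acyclic : Acyclic E) {v₀ : Fin n} (2<deg-v₀ : 2 < deg E v₀) where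

  #good<#deg≥3 : length (filter (Good? E) E) < #deg≥3 E
  #good<#deg≥3 with acyclic⇒edges<nonIsolated (filter (Good? E) E) (simple-filter (Good? E) simple) (acyclic-filter (Good? E) acyclic)
  ... | inj₁ good≡[] = subst (λ G → length G < #deg≥3 E) (sym good≡[]) (count-pos (λ v → 3 ≤? deg E v) 2<deg-v₀)
  ... | inj₂ good<    = ≤-trans good< (count-mono (λ v → 1 ≤? deg (filter (Good? E) E) v) (λ v → 3 ≤? deg E v) (good-edge-endpoint E))

  #edges<n : length E < n
  #edges<n with acyclic⇒edges<nonIsolated E simple acyclic
  ... | inj₁ refl = contradiction 2<deg-v₀ λ ()
  ... | inj₂ E<   = ≤-trans E< (count≤n (λ v → 1 ≤? deg E v))

  module _ (deg-pos : ∀ v → 1 ≤ deg E v) {δ} (δ-min : ∀ v → 2 < deg E v → δ ≤ deg E v) where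

    #deg≥3-bound : #deg≥3 E * (δ ∸ 1) + 2 ≤ #deg≢2 E
    #deg≥3-bound = +-cancelˡ-≤ (n * 2) _ _ (begin
      n * 2 + (#deg≥3 E * (δ ∸ 1) + 2)                               ≡⟨ +-assoc (n * 2) _ 2 ⟨
      n * 2 + #deg≥3 E * (δ ∸ 1) + 2                                 ≡⟨ cong (_+ 2) (+-comm (n * 2) _) ⟩
      #deg≥3 E * (δ ∸ 1) + n * 2 + 2                                 ≡⟨ cong (_+ 2) lhs ⟨
      sum (λ v → 𝟙 (3 ≤? deg E v) * (δ ∸ 1) + 2) + 2                 ≤⟨ +-monoˡ-≤ 2 (sum-mono-≤ (λ v → deg-contribution (deg E v) (deg-pos v) (δ-min v))) ⟩
      sum (λ v → 𝟙 (¬? (deg E v ≟ 2)) + deg E v) + 2                 ≡⟨ cong (_+ 2) rhs ⟩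
      #deg≢2 E + 2 * length E + 2                                    ≡⟨ +-assoc (#deg≢2 E) _ 2 ⟩
      #deg≢2 E + (2 * length E + 2)                                  ≤⟨ +-monoʳ-≤ (#deg≢2 E) 2+2|E|≤2n ⟩
      #deg≢2 E + n * 2                                               ≡⟨ +-comm (#deg≢2 E) (n * 2) ⟩
      n * 2 + #deg≢2 E                                               ∎)
      where
      open ≤-Reasoning
      lhs : sum (λ v → 𝟙 (3 ≤? deg E v) * (δ ∸ 1) + 2) ≡ #deg≥3 E * (δ ∸ 1) + n * 2
      lhs = trans (∑-distrib-+ (λ v → 𝟙 (3 ≤? deg E v) * (δ ∸ 1)) (λ _ → 2))
                  (cong₂ _+_ (sym (*-distribʳ-sum (δ ∸ 1) (λ v → 𝟙 (3 ≤? deg E v)))) (sum-const n 2))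
      rhs : sum (λ v → 𝟙 (¬? (deg E v ≟ 2)) + deg E v) ≡ #deg≢2 E + 2 * length E
      rhs = trans (∑-distrib-+ (λ v → 𝟙 (¬? (deg E v ≟ 2))) (deg E)) (cong (#deg≢2 E +_) (handshake E (proj₁ simple)))
      2+2|E|≤2n : 2 * length E + 2 ≤ n * 2
      2+2|E|≤2n = begin
        2 * length E + 2    ≡⟨ +-comm (2 * length E) 2 ⟩
        2 + 2 * length E    ≡⟨ *-suc 2 (length E) ⟨
        2 * suc (length E)  ≤⟨ *-monoʳ-≤ 2 #edges<n ⟩
        2 * n               ≡⟨ *-comm 2 n ⟩
        n * 2               ∎

lemma22 : (n : ℕ) (E : List (Edge n)) → IsTree n E →
          -- maximal degree Δ > 2
          (∃[ v ] 2 < deg E v) →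
          -- δ_T = min { deg v : deg v > 2 }
          (δ : ℕ) → (∃[ v ] (2 < deg E v × deg E v ≡ δ)) →
          ((v : Fin n) → 2 < deg E v → δ ≤ deg E v) →
          -- T2 = T^2 with n' nodes
          (n′ : ℕ) (E′ : List (Edge n′)) → IsSmoothing (n , E) (n′ , E′) →
          -- |E_pure(T)| ≤ 2^((n'-2)/(δ-1) - 1), raised to the power δ-1
          numPure E ^ (δ ∸ 1) * 2 ^ (δ ∸ 1) ≤ 2 ^ (n′ ∸ 2)
lemma22 n E (_ , simple , connected , acyclic) (v₀ , 2<deg-v₀) δ _ δ-min n′ E′ (smoothing , _) = begin
  numPure E ^ (δ ∸ 1) * 2 ^ (δ ∸ 1)   ≤⟨ *-monoˡ-≤ (2 ^ (δ ∸ 1)) (^-monoˡ-≤ (δ ∸ 1) (numPure≤2^#good E)) ⟩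
  (2 ^ #good) ^ (δ ∸ 1) * 2 ^ (δ ∸ 1) ≡⟨ ^-*-suc 2 #good (δ ∸ 1) ⟩
  2 ^ (suc #good * (δ ∸ 1))           ≤⟨ ^-monoʳ-≤ 2 (*-monoˡ-≤ (δ ∸ 1) (#good<#deg≥3 simple acyclic 2<deg-v₀)) ⟩
  2 ^ (#deg≥3 E * (δ ∸ 1))            ≤⟨ ^-monoʳ-≤ 2 (m+n≤o⇒m≤o∸n (#deg≥3 E * (δ ∸ 1)) {2} #deg≥3[δ∸1]+2≤n′) ⟩
  2 ^ (n′ ∸ 2)                        ∎
  where
  open ≤-Reasoning
  #good : ℕ
  #good = length (filter (Good? E) E)
  #deg≢2≤n′ : #deg≢2 E ≤ n′
  #deg≢2≤n′ = subst (_≤ n′) (#deg≢2-smoothing smoothing (simple , acyclic)) (count≤n (λ v → ¬? (deg E′ v ≟ 2)))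
  #deg≥3[δ∸1]+2≤n′ : #deg≥3 E * (δ ∸ 1) + 2 ≤ n′
  #deg≥3[δ∸1]+2≤n′ = ≤-trans (#deg≥3-bound simple acyclic 2<deg-v₀ (connected⇒deg-pos connected (≤-trans (s≤s z≤n) 2<deg-v₀)) δ-min) #deg≢2≤n′
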